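{- Let $\mathcal{A}$ be a finite alphabet of modalities and $\mathcal{F}$ a class of $\mathcal{A}$-frames. The logic of $\mathcal{F}$ is locally tabular if and only if the logic of $\mathrm{Sub}(\mathcal{F})=\{F\restriction Y \mid F\in\mathcal{F},\ Y\subseteq\mathrm{dom}(F)\}$ is locally tabular.
   Context: Modal formulas over a finite set $\mathcal{A}$ of unary modalities are built from variables $p_0,p_1,\ldots$ using $\bot,\to$ and $\Diamond\in\mathcal{A}$. An $\mathcal{A}$-frame is $F=(X,(R_\Diamond)_{\Diamond\in\mathcal{A}})$ with $R_\Diamond\subseteq X\times X$. The logic of a class of frames is the set of formulas valid in all its frames. For $Y\subseteq X$, $F\restriction Y=(Y,(R_\Diamond\cap(Y\times Y))_{\Diamond\in\mathcal{A}})$. A logic $L$ is locally tabular if for every $k<\omega$ there are only finitely many formulas in variables $p_0,\ldots,p_{k-1}$ pairwise non-equivalent modulo $L$. -}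

module Defs where

open import Data.Nat using (ℕ; _<_)
open import Data.Fin using (Fin)
open import Data.Product using (Σ; _×_; _,_; proj₁)
open import Data.Empty using (⊥)
open import Data.Unit using (⊤)
open import Relation.Nullary using (¬_)
open import Relation.Binary.PropositionalEquality using (_≡_)

data Fm (m : ℕ) : Set where
  var  : ℕ → Fm m
  bot  : Fm m
  _⇒_  : Fm m → Fm m → Fm m
  dia  : Fin m → Fm m → Fm m

infixr 5 _⇒_

neg : ∀ {m} → Fm m → Fm m
neg φ = φ ⇒ bot

_∧_ : ∀ {m} → Fm m → Fm m → Fm m
φ ∧ ψ = neg (φ ⇒ neg ψ)

_⇔_ : ∀ {m} → Fm m → Fm m → Fm m
φ ⇔ ψ = (φ ⇒ ψ) ∧ (ψ ⇒ φ)

VarsBelow : ∀ {m} → ℕ → Fm m → Set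
VarsBelow k (var i)  = i < k
VarsBelow k bot      = ⊤
VarsBelow k (φ ⇒ ψ)  = VarsBelow k φ × VarsBelow k ψ
VarsBelow k (dia a φ) = VarsBelow k φ

record Frame (m : ℕ) : Set₁ where
  field
    X : Set
    R : Fin m → X → X → Set

open Frame public

restrict : ∀ {m} (F : Frame m) → (X F → Set) → Frame m
restrict F Y = record
  { X = Σ (X F) Y
  ; R = λ a x y → R F a (proj₁ x) (proj₁ y) }

-- Classical (Kripke) semantics, rendered constructively via the
-- Gödel–Gentzen negative translation, so every truth value is ¬¬-stable
-- and classical reasoning about truth is valid.
Valuation : ∀ {m} → Frame m → Set₁
Valuation F = ℕ → X F → Set

sat : ∀ {m} (F : Frame m) → Valuation F → Fm m → X F → Set
sat F V (var i) x   = ¬ ¬ V i x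
sat F V bot x       = ⊥
sat F V (φ ⇒ ψ) x   = sat F V φ x → sat F V ψ x
sat F V (dia a φ) x = ¬ ¬ Σ (X F) λ y → R F a x y × sat F V φ y

Valid : ∀ {m} → Frame m → Fm m → Set₁
Valid F φ = (V : Valuation F) (x : X F) → sat F V φ x

Class : ℕ → Set₂
Class m = Frame m → Set₁

Logic : ℕ → Set₂
Logic m = Fm m → Set₁

LogOf : ∀ {m} → Class m → Logic m
LogOf C φ = (F : Frame _) → C F → Valid F φ

Sub : ∀ {m} → Class m → Class m
Sub C G = Σ (Frame _) λ F → C F × Σ (X F → Set) λ Y → G ≡ restrict F Y

LocallyTabular : ∀ {m} → Logic m → Set₁
LocallyTabular {m} L = (k : ℕ) → Σ ℕ λ n → Σ (Fin n → Fm m) λ f →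
  ((i : Fin n) → VarsBelow k (f i)) ×
  ((φ : Fm m) → VarsBelow k φ → Σ (Fin n) λ i → L (φ ⇔ f i))

{-# OPTIONS --safe #-}
-- Every frame is isomorphic to its restriction to its whole domain, so Log Sub(𝒞) ⊆ Log 𝒞,
-- and local tabularity passes from the smaller logic to the larger one.
-- Conversely, fix k and let τ range over the 2^k truth assignments ("types") to p₀ … p_{k-1}.
-- Truth of φ at a point of type τ in F ↾ Y is truth of a formula tr τ φ in F itself:
-- the variables become ⊤ or ⊥ as τ prescribes, and ◇ψ becomes ◇ ⋁_υ (p_υ ∧ tr υ ψ),
-- where the fresh variable p_υ is made true exactly at the points of Y of type υ.
-- Hence the 𝒞-classes of the 2^k formulas tr τ φ, which live in 2^k variables, determine
-- the Sub(𝒞)-class of φ. There are finitely many such tuples of classes, so saturating a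
-- family of formulas under ⇒ and ◇ until no new tuple appears yields finitely many
-- representatives.
module Submission where

open import Defs
open import Data.Nat using (ℕ; zero; suc; _+_; _^_; _<_; _<?_; s≤s)
open import Data.Nat.Properties using (≤-trans; ≤-reflexive; ≤⇒≯; +-suc; +-identityʳ; +-monoˡ-≤; m≤n+m)
open import Data.Fin using (Fin; toℕ; fromℕ<; funToFin; finToFun) renaming (zero to fzero; suc to fsuc)
open import Data.Fin.Properties using (toℕ-injective; toℕ<n; toℕ-fromℕ<; all?; ¬∀⟶∃¬; finToFun-funToFin)
open import Data.Fin.Subset using (Subset; _∈_; _∉_; _⊂_; ⁅_⁆; _∪_; ∣_∣) renaming (⊥ to ∅)
open import Data.Fin.Subset.Properties using (_∈?_; ∉⊥; x∈⁅x⁆; x∈⁅y⁆⇒x≡y; x∈p∪q⁻; p⊆p∪q; q⊆p∪q; ∣p∣≤n; p⊂q⇒∣p∣<∣q∣)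
open import Data.Vec.Functional as Vec using (Vector; head; tail)
open import Data.List using (List; []; _∷_; map; foldr; allFin)
open import Data.List.Relation.Unary.Any using (Any; here; there; satisfied)
import Data.List.Relation.Unary.Any.Properties as Any
open import Data.List.Membership.Propositional using (lose)
open import Data.List.Membership.Propositional.Properties using (∈-allFin)
open import Data.Product using (Σ; ∃; ∃₂; _×_; _,_; proj₁; proj₂; map₂)
open import Data.Sum using (_⊎_; inj₁; inj₂)
open import Data.Empty using (⊥-elim)
open import Data.Unit using (⊤; tt)
open import Effect.Monad using (RawMonad)
open import Function using (_∘_; id)
open import Function.Bundles using (mk⇔; module Equivalence) renaming (_⇔_ to _⟺_)
import Function.Properties.Equivalence as ⟺
open import Function.Related.TypeIsomorphisms using (→-cong-⇔; ¬-cong-⇔)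
open import Relation.Binary.PropositionalEquality using (_≡_; refl; sym; cong; subst; module ≡-Reasoning)
open import Relation.Nullary using (¬_; Dec; yes; no; contradiction)
open import Relation.Nullary.Decidable using (¬¬-excluded-middle)
open import Relation.Nullary.Negation using (¬¬-Monad; ¬¬-map; Stable; negated-stable)
open import Relation.Unary using (Pred; Decidable)

open module ¬¬ {a} = RawMonad (¬¬-Monad {a})
open Equivalence using (to; from)

_∨_ : ∀ {m} → Fm m → Fm m → Fm m
φ ∨ ψ = neg φ ⇒ ψ

⋁ : ∀ {m} → List (Fm m) → Fm m
⋁ = foldr _∨_ bot

module _ {m} {F : Frame m} {V : Valuation F} where

  sat-stable : ∀ φ {x} → Stable (sat F V φ x)
  sat-stable (var i)   ¬¬s   = negated-stable ¬¬s
  sat-stable bot       ¬¬s   = ¬¬s id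
  sat-stable (φ ⇒ ψ)   ¬¬s s = sat-stable ψ (¬¬-map (λ f → f s) ¬¬s)
  sat-stable (dia a φ) ¬¬s   = negated-stable ¬¬s

  ∧-sat : ∀ {φ ψ x} → sat F V (φ ∧ ψ) x ⟺ (sat F V φ x × sat F V ψ x)
  ∧-sat {φ} {ψ} = mk⇔
    (λ s → sat-stable φ (λ ¬a → s (λ a _ → ¬a a)) , sat-stable ψ (λ ¬b → s (λ _ b → ¬b b)))
    (λ (a , b) k → k a b)

  ⇔-sat : ∀ φ ψ {x} → sat F V (φ ⇔ ψ) x ⟺ (sat F V φ x ⟺ sat F V ψ x)
  ⇔-sat φ ψ = ⟺.trans (∧-sat {φ ⇒ ψ} {ψ ⇒ φ})
    (mk⇔ (λ (f , g) → mk⇔ f g) (λ e → to e , from e))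

  ⋁-intro : ∀ {l x} → Any (λ φ → sat F V φ x) l → sat F V (⋁ l) x
  ⋁-intro (here s)  ¬s = ⊥-elim (¬s s)
  ⋁-intro (there s) _  = ⋁-intro s

  ⋁-elim : ∀ l {x} → sat F V (⋁ l) x → ¬ ¬ Any (λ φ → sat F V φ x) l
  ⋁-elim []      ()
  ⋁-elim (φ ∷ l) s ¬any = ⋁-elim l (s (λ a → ¬any (here a))) (¬any ∘ there)

⋁-VarsBelow : ∀ {m n} {A : Set} (g : A → Fm m) → (∀ a → VarsBelow n (g a)) →
  ∀ l → VarsBelow n (⋁ (map g l))
⋁-VarsBelow g vg []      = tt
⋁-VarsBelow g vg (a ∷ l) = ((vg a , tt) , ⋁-VarsBelow g vg l)

module _ {m} {C : Class m} where

  valid-⇔-sym : ∀ {φ ψ} → LogOf C (φ ⇔ ψ) → LogOf C (ψ ⇔ φ)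
  valid-⇔-sym {φ} {ψ} e F c V x = from (⇔-sat ψ φ) (⟺.sym (to (⇔-sat φ ψ) (e F c V x)))

  valid-⇔-trans : ∀ {φ ψ χ} → LogOf C (φ ⇔ ψ) → LogOf C (ψ ⇔ χ) → LogOf C (φ ⇔ χ)
  valid-⇔-trans {φ} {ψ} {χ} e e′ F c V x =
    from (⇔-sat φ χ) (⟺.trans (to (⇔-sat φ ψ) (e F c V x)) (to (⇔-sat ψ χ) (e′ F c V x)))

  valid-⇒-cong : ∀ {φ φ′ ψ ψ′} → LogOf C (φ ⇔ φ′) → LogOf C (ψ ⇔ ψ′) →
    LogOf C ((φ ⇒ ψ) ⇔ (φ′ ⇒ ψ′))
  valid-⇒-cong {φ} {φ′} {ψ} {ψ′} e e′ F c V x = from (⇔-sat (φ ⇒ ψ) (φ′ ⇒ ψ′))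
    (→-cong-⇔ (to (⇔-sat φ φ′) (e F c V x)) (to (⇔-sat ψ ψ′) (e′ F c V x)))

  valid-dia-cong : ∀ {φ ψ} a → LogOf C (φ ⇔ ψ) → LogOf C (dia a φ ⇔ dia a ψ)
  valid-dia-cong {φ} {ψ} a e F c V x = from (⇔-sat (dia a φ) (dia a ψ)) (¬-cong-⇔ (¬-cong-⇔ (mk⇔
    (map₂ (map₂ (to (to (⇔-sat φ ψ) (e F c V _)))))
    (map₂ (map₂ (from (to (⇔-sat φ ψ) (e F c V _))))))))

restrict-full : ∀ {m} {F : Frame m} {V : Valuation F} φ {x} →
  sat (restrict F (λ _ → ⊤)) (λ i → V i ∘ proj₁) φ (x , tt) ⟺ sat F V φ x
restrict-full (var i)   = ⟺.refl
restrict-full bot       = ⟺.refl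
restrict-full (φ ⇒ ψ)   = →-cong-⇔ (restrict-full φ) (restrict-full ψ)
restrict-full (dia a φ) = ¬-cong-⇔ (¬-cong-⇔ (mk⇔
  (λ ((y , _) , r , s) → y , r , to (restrict-full φ) s)
  (λ (y , r , s) → (y , tt) , r , from (restrict-full φ) s)))

LogOf-Sub⊆LogOf : ∀ {m} {C : Class m} φ → LogOf (Sub C) φ → LogOf C φ
LogOf-Sub⊆LogOf φ valid F c V x =
  to (restrict-full φ) (valid _ (F , c , (λ _ → ⊤) , refl) (λ i → V i ∘ proj₁) (x , tt))

LocallyTabular-mono : ∀ {m} {L L′ : Logic m} → (∀ φ → L φ → L′ φ) →
  LocallyTabular L → LocallyTabular L′
LocallyTabular-mono L⊆L′ tabular k =
  let n , f , f-vars , classify = tabular k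
  in n , f , f-vars , λ φ vφ → let i , φ≡fi = classify φ vφ in i , L⊆L′ (φ ⇔ f i) φ≡fi

∀⊎∃¬ : ∀ {n p} {P : Pred (Fin n) p} → Decidable P → (∀ i → P i) ⊎ ∃ λ i → ¬ P i
∀⊎∃¬ P? with all? P?
... | yes ∀P = inj₁ ∀P
... | no ¬∀P = inj₂ (¬∀⟶∃¬ _ _ P? ¬∀P)

∀₂⊎∃₂¬ : ∀ {n n′ p} {P : Fin n → Fin n′ → Set p} → (∀ i j → Dec (P i j)) →
  (∀ i j → P i j) ⊎ ∃₂ λ i j → ¬ P i j
∀₂⊎∃₂¬ P? with ∀⊎∃¬ (λ i → all? (P? i))
... | inj₁ ∀P       = inj₁ ∀P
... | inj₂ (i , ¬∀P) = inj₂ (i , ¬∀⟶∃¬ _ _ (P? i) ¬∀P)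

module FiniteIndex {m k N ℓ} (_~_ : Fm m → Fm m → Set ℓ)
  (~-trans : ∀ {φ ψ χ} → φ ~ ψ → ψ ~ χ → φ ~ χ)
  (~-⇒-cong : ∀ {φ φ′ ψ ψ′} → φ ~ φ′ → ψ ~ ψ′ → (φ ⇒ ψ) ~ (φ′ ⇒ ψ′))
  (~-dia-cong : ∀ {φ ψ} a → φ ~ ψ → dia a φ ~ dia a ψ)
  (key : Fm m → Fin N)
  (key-sound : ∀ {φ ψ} → VarsBelow k φ → VarsBelow k ψ → key φ ≡ key ψ → φ ~ ψ)
  where

  keys : ∀ {s} → Vector (Fm m) s → Subset N
  keys {zero}  W = ∅
  keys {suc s} W = ⁅ key (head W) ⁆ ∪ keys (tail W)

  ∈-keys⁻ : ∀ {s} (W : Vector (Fm m) s) {e} → e ∈ keys W → ∃ λ i → key (W i) ≡ e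
  ∈-keys⁻ {zero}  W e∈ = ⊥-elim (∉⊥ e∈)
  ∈-keys⁻ {suc s} W e∈ with x∈p∪q⁻ _ _ e∈
  ... | inj₁ e∈⁅⁆ = fzero , sym (x∈⁅y⁆⇒x≡y _ e∈⁅⁆)
  ... | inj₂ e∈′  = let i , eq = ∈-keys⁻ (tail W) e∈′ in fsuc i , eq

  FormulasBelow : ∀ {s} → Vector (Fm m) s → Set
  FormulasBelow W = ∀ i → VarsBelow k (W i)

  record Closed {s} (W : Vector (Fm m) s) : Set where
    field
      var∈ : (j : Fin k) → key (var (toℕ j)) ∈ keys W
      bot∈ : key bot ∈ keys W
      ⇒∈   : ∀ i j → key (W i ⇒ W j) ∈ keys W
      dia∈ : ∀ a i → key (dia a (W i)) ∈ keys W

  Unrepresented : ∀ {s} → Vector (Fm m) s → Set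
  Unrepresented W = Σ (Fm m) λ φ → VarsBelow k φ × key φ ∉ keys W

  closed? : ∀ {s} (W : Vector (Fm m) s) → FormulasBelow W → Closed W ⊎ Unrepresented W
  closed? W W-vars
    with ∀⊎∃¬ (λ j → key (var (toℕ j)) ∈? keys W) | key bot ∈? keys W
       | ∀₂⊎∃₂¬ (λ i j → key (W i ⇒ W j) ∈? keys W) | ∀₂⊎∃₂¬ (λ a i → key (dia a (W i)) ∈? keys W)
  ... | inj₁ v | yes b | inj₁ i | inj₁ d = inj₁ (record { var∈ = v ; bot∈ = b ; ⇒∈ = i ; dia∈ = d })
  ... | inj₂ (j , ∉) | _ | _ | _ = inj₂ (var (toℕ j) , toℕ<n j , ∉)
  ... | _ | no ∉ | _ | _ = inj₂ (bot , tt , ∉)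
  ... | _ | _ | inj₂ (i , j , ∉) | _ = inj₂ (W i ⇒ W j , (W-vars i , W-vars j) , ∉)
  ... | _ | _ | _ | inj₂ (a , i , ∉) = inj₂ (dia a (W i) , W-vars i , ∉)

  represented : ∀ {s} (W : Vector (Fm m) s) → FormulasBelow W →
    ∀ {φ} → VarsBelow k φ → key φ ∈ keys W → ∃ λ i → φ ~ W i
  represented W W-vars vφ φ∈ =
    let i , eq = ∈-keys⁻ W φ∈ in i , key-sound vφ (W-vars i) (sym eq)

  cover : ∀ {s} (W : Vector (Fm m) s) → FormulasBelow W → Closed W →
    ∀ φ → VarsBelow k φ → ∃ λ i → φ ~ W i
  cover W W-vars closed = go
    where
    open Closed closed
    rep : ∀ {φ} → VarsBelow k φ → key φ ∈ keys W → ∃ λ i → φ ~ W i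
    rep = represented W W-vars
    go : ∀ φ → VarsBelow k φ → ∃ λ i → φ ~ W i
    go (var i) i<k = rep i<k (subst (λ j → key (var j) ∈ keys W) (toℕ-fromℕ< i<k) (var∈ (fromℕ< i<k)))
    go bot _ = rep tt bot∈
    go (φ ⇒ ψ) (vφ , vψ) =
      let i , φ~ = go φ vφ
          j , ψ~ = go ψ vψ
          l , ⇒~ = rep (W-vars i , W-vars j) (⇒∈ i j)
      in l , ~-trans (~-⇒-cong φ~ ψ~) ⇒~
    go (dia a φ) vφ =
      let i , φ~ = go φ vφ
          l , dia~ = rep (W-vars i) (dia∈ a i)
      in l , ~-trans (~-dia-cong a φ~) dia~

  keys-⊂ : ∀ {s} (W : Vector (Fm m) s) {φ} → key φ ∉ keys W → keys W ⊂ keys (φ Vec.∷ W)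
  keys-⊂ W {φ} φ∉ = q⊆p∪q _ (keys W) , key φ , p⊆p∪q (keys W) (x∈⁅x⁆ (key φ)) , φ∉

  -- Every round adds a formula with a new key, so N + 1 rounds of fuel suffice.
  saturate : ∀ fuel {s} (W : Vector (Fm m) s) → FormulasBelow W → N < ∣ keys W ∣ + fuel →
    Σ ℕ λ s′ → Σ (Vector (Fm m) s′) λ W′ → FormulasBelow W′ × Closed W′
  saturate zero W W-vars N< = contradiction (subst (N <_) (+-identityʳ _) N<) (≤⇒≯ (∣p∣≤n (keys W)))
  saturate (suc fuel) {s} W W-vars N< with closed? W W-vars
  ... | inj₁ closed = s , W , W-vars , closed
  ... | inj₂ (φ , vφ , φ∉) = saturate fuel (φ Vec.∷ W) W′-vars N<′
    where
    W′-vars : FormulasBelow (φ Vec.∷ W)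
    W′-vars fzero    = vφ
    W′-vars (fsuc i) = W-vars i
    N<′ : N < ∣ keys (φ Vec.∷ W) ∣ + fuel
    N<′ = ≤-trans N< (≤-trans (≤-reflexive (+-suc ∣ keys W ∣ fuel))
                             (+-monoˡ-≤ fuel (p⊂q⇒∣p∣<∣q∣ (keys-⊂ W φ∉))))

  representatives : Σ ℕ λ s → Σ (Vector (Fm m) s) λ W →
    FormulasBelow W × (∀ φ → VarsBelow k φ → ∃ λ i → φ ~ W i)
  representatives =
    let s , W , W-vars , closed = saturate (suc N) Vec.[] (λ ()) (m≤n+m (suc N) _)
    in s , W , W-vars , cover W W-vars closed

-- Truth values are Fin 2 (fzero is false), so that an assignment Fin k → Fin 2 to the first
-- k variables is coded by an element of Fin (2 ^ k) via funToFin.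
Truth : Fin 2 → Set → Set
Truth fzero        A = ¬ A
Truth (fsuc fzero) A = ¬ ¬ A

truth-of : ∀ {A} → Dec A → Σ (Fin 2) λ b → Truth b A
truth-of (yes a) = fsuc fzero , λ ¬a → ¬a a
truth-of (no ¬a) = fzero , ¬a

truthFm : ∀ {m} → Fin 2 → Fm m
truthFm fzero        = bot
truthFm (fsuc fzero) = bot ⇒ bot

truthFm-VarsBelow : ∀ {m n} b → VarsBelow n (truthFm {m} b)
truthFm-VarsBelow fzero        = tt
truthFm-VarsBelow (fsuc fzero) = tt , tt

sat-truthFm : ∀ {m} {F : Frame m} {V x} b {A} → Truth b A → (¬ ¬ A) ⟺ sat F V (truthFm b) x
sat-truthFm fzero        ¬a  = mk⇔ (λ ¬¬a → ¬¬a ¬a) ⊥-elim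
sat-truthFm (fsuc fzero) ¬¬a = mk⇔ (λ _ → id) (λ _ → ¬¬a)

Match : ∀ {k} → (Fin k → Fin 2) → (ℕ → Set) → Set
Match {k} σ P = ∀ i (i<k : i < k) → Truth (σ (fromℕ< i<k)) (P i)

some-match : ∀ k (P : ℕ → Set) → ¬ ¬ Σ (Fin k → Fin 2) λ σ → Match σ P
some-match zero    P = return ((λ ()) , λ _ ())
some-match (suc k) P = do
  p₀? ← ¬¬-excluded-middle
  σ , σ-match ← some-match k (P ∘ suc)
  let b , b-truth = truth-of p₀?
  return (b Vec.∷ σ , λ { zero _ → b-truth ; (suc i) (s≤s i<k) → σ-match i i<k })

some-code : ∀ k (P : ℕ → Set) → ¬ ¬ Σ (Fin (2 ^ k)) λ τ → Match {k} (finToFun τ) P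
some-code k P = do
  σ , σ-match ← some-match k P
  return (funToFin σ , λ i i<k →
    subst (λ b → Truth b (P i)) (sym (finToFun-funToFin σ (fromℕ< i<k))) (σ-match i i<k))

module Translation (m k : ℕ) where

  Code : Set
  Code = Fin (2 ^ k)

  atom : Code → ℕ → Fm m
  atom τ i with i <? k
  ... | yes i<k = truthFm (finToFun τ (fromℕ< i<k))
  ... | no _    = bot

  marker : Code → Fm m
  marker τ = var (toℕ τ)

  tr : Code → Fm m → Fm m
  tr τ (var i)   = atom τ i
  tr τ bot       = bot
  tr τ (φ ⇒ ψ)   = tr τ φ ⇒ tr τ ψ
  tr τ (dia a φ) = dia a (⋁ (map (λ υ → marker υ ∧ tr υ φ) (allFin (2 ^ k))))

  tr-VarsBelow : ∀ τ φ → VarsBelow (2 ^ k) (tr τ φ)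
  tr-VarsBelow τ (var i) with i <? k
  ... | yes i<k = truthFm-VarsBelow (finToFun τ (fromℕ< i<k))
  ... | no _    = tt
  tr-VarsBelow τ bot       = tt
  tr-VarsBelow τ (φ ⇒ ψ)   = tr-VarsBelow τ φ , tr-VarsBelow τ ψ
  tr-VarsBelow τ (dia a φ) =
    ⋁-VarsBelow _ (λ υ → ((toℕ<n υ , (tr-VarsBelow υ φ , tt)) , tt)) (allFin (2 ^ k))

  module _ (F : Frame m) (Y : X F → Set) (V : Valuation (restrict F Y)) where

    HasType : Code → Σ (X F) Y → Set
    HasType τ p = Match {k} (finToFun τ) (λ i → V i p)

    markerVal : Valuation F
    markerVal j x = Σ (Y x) λ y → Σ Code λ τ → toℕ τ ≡ j × HasType τ (x , y)

    sat-marker : ∀ {τ x y} → HasType τ (x , y) → sat F markerVal (marker τ) x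
    sat-marker {τ} {x} {y} τ-type ¬marked = ¬marked (y , τ , refl , τ-type)

    sat-marker⁻ : ∀ {τ x} → sat F markerVal (marker τ) x → ¬ ¬ ∃ λ y → HasType τ (x , y)
    sat-marker⁻ marked = do
      y , υ , υ≡τ , υ-type ← marked
      return (y , subst (λ τ → HasType τ _) (toℕ-injective υ≡τ) υ-type)

    tr-correct : ∀ φ → VarsBelow k φ → ∀ {x y τ} → HasType τ (x , y) →
      sat (restrict F Y) V φ (x , y) ⟺ sat F markerVal (tr τ φ) x
    tr-correct (var i) i<k {τ = τ} τ-type with i <? k
    ... | yes i<k′ = sat-truthFm (finToFun τ (fromℕ< i<k′)) (τ-type i i<k′)
    ... | no i≮k   = contradiction i<k i≮k
    tr-correct bot     _          _      = ⟺.refl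
    tr-correct (φ ⇒ ψ) (vφ , vψ) τ-type = →-cong-⇔ (tr-correct φ vφ τ-type) (tr-correct ψ vψ τ-type)
    tr-correct (dia a φ) vφ {x} {y} {τ} _ = mk⇔ forth back
      where
      disjunct : Code → Fm m
      disjunct υ = marker υ ∧ tr υ φ

      forth : sat (restrict F Y) V (dia a φ) (x , y) → sat F markerVal (tr τ (dia a φ)) x
      forth h = do
        (x′ , y′) , r , s ← h
        υ , υ-type ← some-code k (λ i → V i (x′ , y′))
        return (x′ , r , ⋁-intro (Any.map⁺ (lose (∈-allFin υ)
          (from (∧-sat {φ = marker υ} {ψ = tr υ φ}) (sat-marker υ-type , to (tr-correct φ vφ υ-type) s)))))

      back : sat F markerVal (tr τ (dia a φ)) x → sat (restrict F Y) V (dia a φ) (x , y)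
      back h = do
        x′ , r , s ← h
        some-disjunct ← ⋁-elim (map disjunct (allFin (2 ^ k))) s
        let υ , s′ = satisfied (Any.map⁻ some-disjunct)
            marked , t = to (∧-sat {φ = marker υ} {ψ = tr υ φ}) s′
        y′ , υ-type ← sat-marker⁻ marked
        return ((x′ , y′) , r , from (tr-correct φ vφ υ-type) t)

module SubTabular {m} (C : Class m) (k : ℕ) {n} (f : Fin n → Fm m)
  (classify : (φ : Fm m) → VarsBelow (2 ^ k) φ → Σ (Fin n) λ i → LogOf C (φ ⇔ f i)) where

  open Translation m k

  class : Code → Fm m → Fin n
  class τ φ = proj₁ (classify (tr τ φ) (tr-VarsBelow τ φ))

  key : Fm m → Fin (n ^ 2 ^ k)
  key φ = funToFin (λ τ → class τ φ)

  key-class : ∀ φ ψ → key φ ≡ key ψ → ∀ τ → class τ φ ≡ class τ ψ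
  key-class φ ψ eq τ = begin
    class τ φ           ≡⟨ finToFun-funToFin (λ υ → class υ φ) τ ⟨
    finToFun (key φ) τ  ≡⟨ cong (λ c → finToFun c τ) eq ⟩
    finToFun (key ψ) τ  ≡⟨ finToFun-funToFin (λ υ → class υ ψ) τ ⟩
    class τ ψ           ∎
    where open ≡-Reasoning

  key-tr-valid : ∀ φ ψ → key φ ≡ key ψ → ∀ τ → LogOf C (tr τ φ ⇔ tr τ ψ)
  key-tr-valid φ ψ eq τ = valid-⇔-trans
    (subst (λ i → LogOf C (tr τ φ ⇔ f i)) (key-class φ ψ eq τ) (proj₂ (classify (tr τ φ) _)))
    (valid-⇔-sym (proj₂ (classify (tr τ ψ) _)))

  key-sound : ∀ {φ ψ} → VarsBelow k φ → VarsBelow k ψ → key φ ≡ key ψ → LogOf (Sub C) (φ ⇔ ψ)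
  key-sound {φ} {ψ} vφ vψ eq _ (F , c , Y , refl) V (x , y) = sat-stable (φ ⇔ ψ) do
    τ , τ-type ← some-code k (λ i → V i (x , y))
    return (from (⇔-sat φ ψ) (⟺.trans (tr-correct F Y V φ vφ τ-type)
      (⟺.trans (to (⇔-sat (tr τ φ) (tr τ ψ)) (key-tr-valid φ ψ eq τ F c (markerVal F Y V) x))
               (⟺.sym (tr-correct F Y V ψ vψ τ-type)))))

  open FiniteIndex {k = k} (λ φ ψ → LogOf (Sub C) (φ ⇔ ψ))
    valid-⇔-trans valid-⇒-cong valid-dia-cong key key-sound
    public using (representatives)

LogOf-Sub-tabular : ∀ {m} (C : Class m) → LocallyTabular (LogOf C) → LocallyTabular (LogOf (Sub C))
LogOf-Sub-tabular C tabular k =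
  let _ , f , _ , classify = tabular (2 ^ k)
  in SubTabular.representatives C k f classify

corollary3p2 : (m : ℕ) (C : Class m) →
    (LocallyTabular (LogOf C) → LocallyTabular (LogOf (Sub C))) ×
    (LocallyTabular (LogOf (Sub C)) → LocallyTabular (LogOf C))
corollary3p2 m C = LogOf-Sub-tabular C , LocallyTabular-mono LogOf-Sub⊆LogOf
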